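{- Let $n\ge 1$ and let $BH_n$ be the $n$-dimensional balanced hypercube. Then for every integer $h$ with $0\le h\le 2n$, the $h$-edge tolerable diagnosability satisfies $t_h^e(BH_n)\le 2n-h$, both under the PMC model and under the MM$^*$ model.
   Context: The $n$-dimensional balanced hypercube $BH_n$ has vertex set $\{(a_0,a_1,\ldots,a_{n-1}) : a_i\in\{0,1,2,3\}\}$; each vertex $(a_0,\ldots,a_{i-1},a_i,a_{i+1},\ldots,a_{n-1})$ is adjacent to the $2n$ vertices $((a_0\pm1)\bmod 4,a_1,\ldots,a_{n-1})$ and $((a_0\pm1)\bmod 4,a_1,\ldots,a_{i-1},(a_i+(-1)^{a_0})\bmod 4,a_{i+1},\ldots,a_{n-1})$ for $1\le i\le n-1$ (for $n=1$, $BH_1$ is the 4-cycle $0-1-2-3-0$). It is $2n$-regular. For sets $F_1,F_2$, $F_1\triangle F_2=(F_1-F_2)\cup(F_2-F_1)$. A graph $G=(V,E)$ is $t$-diagnosable under the PMC model (where adjacent vertices test one another) iff for any two distinct subsets $F_1,F_2\subseteq V$ with $|F_1|,|F_2|\le t$ there is an edge $uv\in E$ with $u\in V-(F_1\cup F_2)$ and $v\in F_1\triangle F_2$. A graph $G=(V,E)$ is $t$-diagnosable under the MM$^*$ model (comparison model, where every vertex compares each pair of its neighbours) iff for any two distinct subsets $F_1,F_2\subseteq V$ with $|F_1|,|F_2|\le t$ at least one holds: (1) there are $u,w\in V-(F_1\cup F_2)$ and $v\in F_1\triangle F_2$ with $uv,uw\in E$; (2) there are $u,v\in F_1-F_2$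 and $w\in V-(F_1\cup F_2)$ with $uw,vw\in E$; (3) there are $u,v\in F_2-F_1$ and $w\in V-(F_1\cup F_2)$ with $uw,vw\in E$. The diagnosability $t(G)$ is the maximum $t$ such that $G$ is $t$-diagnosable. $G$ is $h$-edge tolerable $t$-diagnosable (under a given model) if for every edge subset $F_e\subseteq E$ with $|F_e|\le h$, the graph $G-F_e$ is $t$-diagnosable; the $h$-edge tolerable diagnosability $t_h^e(G)$ is the maximum such $t$. -}

module Defs where

open import Data.Nat using (ℕ; zero; suc; _≤_)
open import Data.Fin using (Fin; zero; suc)
open import Data.Vec using (Vec; _∷_; _[_]%=_)
open import Data.List using (List; length)
open import Data.List.Membership.Propositional using (_∈_; _∉_)
open import Data.List.Relation.Unary.All using (All)
open import Data.Product using (Σ; ∃; _×_; _,_; uncurry)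
open import Data.Sum using (_⊎_)
open import Relation.Nullary using (¬_)
open import Relation.Binary.PropositionalEquality using (_≡_)

-- Finite vertex subsets are represented by lists; |F| ≤ t is expressed
-- as "F is given by a list of length ≤ t" (a set has at most t elements
-- iff it can be listed with at most t entries).

_∈△_,_ : {V : Set} → V → List V → List V → Set
v ∈△ F₁ , F₂ = (v ∈ F₁ × v ∉ F₂) ⊎ (v ∈ F₂ × v ∉ F₁)

_∉∪_,_ : {V : Set} → V → List V → List V → Set
u ∉∪ F₁ , F₂ = u ∉ F₁ × u ∉ F₂

-- F₁ ≠ F₂ as sets (symmetric difference is nonempty)
Distinct : {V : Set} → List V → List V → Set
Distinct {V} F₁ F₂ = Σ V λ v → v ∈△ F₁ , F₂

PMC-Diagnosable : {V : Set} → (V → V → Set) → ℕ → Set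
PMC-Diagnosable {V} E t =
  (F₁ F₂ : List V) → length F₁ ≤ t → length F₂ ≤ t → Distinct F₁ F₂ →
  Σ V λ u → Σ V λ v → E u v × u ∉∪ F₁ , F₂ × v ∈△ F₁ , F₂

MM*-Diagnosable : {V : Set} → (V → V → Set) → ℕ → Set
MM*-Diagnosable {V} E t =
  (F₁ F₂ : List V) → length F₁ ≤ t → length F₂ ≤ t → Distinct F₁ F₂ →
    (Σ V λ u → Σ V λ w → Σ V λ v →
       u ∉∪ F₁ , F₂ × w ∉∪ F₁ , F₂ × v ∈△ F₁ , F₂ × E u v × E u w)
  ⊎ (Σ V λ u → Σ V λ v → Σ V λ w →
       (u ∈ F₁ × u ∉ F₂) × (v ∈ F₁ × v ∉ F₂) × w ∉∪ F₁ , F₂ × E u w × E v w)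
  ⊎ (Σ V λ u → Σ V λ v → Σ V λ w →
       (u ∈ F₂ × u ∉ F₁) × (v ∈ F₂ × v ∉ F₁) × w ∉∪ F₁ , F₂ × E u w × E v w)

-- G - F_e, where F_e is a list of edges (each edge {u,v} listed as (u , v)
-- in either orientation).
RemoveEdges : {V : Set} → (V → V → Set) → List (V × V) → V → V → Set
RemoveEdges E Fe u v = E u v × ¬ ((u , v) ∈ Fe ⊎ (v , u) ∈ Fe)

EdgeTolerable : {V : Set} → ((V → V → Set) → ℕ → Set) →
                (V → V → Set) → ℕ → ℕ → Set
EdgeTolerable {V} Diag E h t =
  (Fe : List (V × V)) → length Fe ≤ h → All (uncurry E) Fe →
  Diag (RemoveEdges E Fe) t

Vertex : ℕ → Set
Vertex n = Vec (Fin 4) n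

inc4 : Fin 4 → Fin 4
inc4 zero = suc zero
inc4 (suc zero) = suc (suc zero)
inc4 (suc (suc zero)) = suc (suc (suc zero))
inc4 (suc (suc (suc zero))) = zero

dec4 : Fin 4 → Fin 4
dec4 zero = suc (suc (suc zero))
dec4 (suc zero) = zero
dec4 (suc (suc zero)) = suc zero
dec4 (suc (suc (suc zero))) = suc (suc zero)

-- x ↦ x + (-1)^{a₀} mod 4
flipBy : Fin 4 → Fin 4 → Fin 4
flipBy zero = inc4
flipBy (suc zero) = dec4
flipBy (suc (suc zero)) = inc4
flipBy (suc (suc (suc zero))) = dec4

PlusMinusOne : Fin 4 → Fin 4 → Set
PlusMinusOne a b = (b ≡ inc4 a) ⊎ (b ≡ dec4 a)

-- The neighbour rule of BH_n (n ≥ 1); coordinate a_i (1 ≤ i ≤ n-1)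
-- corresponds to index i-1 of the tail vector.
data BHAdj : {n : ℕ} → Vertex n → Vertex n → Set where
  inner : ∀ {m} {a b : Fin 4} {rest : Vertex m} →
          PlusMinusOne a b → BHAdj (a ∷ rest) (b ∷ rest)
  outer : ∀ {m} {a b : Fin 4} {rest : Vertex m} (i : Fin m) →
          PlusMinusOne a b → BHAdj (a ∷ rest) (b ∷ (rest [ i ]%= flipBy a))

BH : (n : ℕ) → Vertex n → Vertex n → Set
BH n u v = BHAdj u v ⊎ BHAdj v u

-- Pick a vertex v of BH_n and list its 2n neighbours.  Deleting the h edges
-- from v to the first h of them leaves a fault set F of the 2n − h remaining
-- neighbours that contains the whole neighbourhood of v.  Then F and F ∪ {v}
-- cannot be told apart: every neighbour of v is faulty in both scenarios, so
-- every test or comparison involving v has a faulty participant besides v and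
-- may return anything.  So no t > 2n − h is diagnosable, in either model.
module Submission where

open import Defs
open import Data.Nat using (ℕ; _≤_; _*_; _∸_)
open import Data.Product using (_×_)

open import Data.Nat using (suc; _+_; _<_)
open import Data.Nat.Properties using (_≤?_; ≰⇒>; <⇒≤; ≤-trans; ≤-reflexive; m⊓n≤m; +-identityʳ)
open import Data.Fin using (Fin) renaming (zero to 0F; suc to 1+)
open import Data.Vec using (_∷_; replicate; _[_]%=_)
open import Data.Vec.Properties using (∷-injectiveˡ; []%=-∘; []%=-id; updateAt-cong)
open import Data.List using (List; _∷_; _++_; map; take; drop; length; tabulate)
open import Data.List.Properties using (length-++; length-drop; length-take; length-map; length-tabulate; take++drop≡id)
open import Data.List.Membership.Propositional using (_∈_; _∉_)
open import Data.List.Membership.Propositional.Properties using (∈-++⁻; ∈-++⁺ˡ; ∈-++⁺ʳ; ∈-map⁺; ∈-tabulate⁺)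
open import Data.List.Relation.Unary.Any using (here; there)
open import Data.List.Relation.Unary.All using (All; _∷_)
import Data.List.Relation.Unary.All as All
import Data.List.Relation.Unary.All.Properties as All
open import Data.Product using (_,_; uncurry)
open import Data.Sum using (_⊎_; inj₁; inj₂; swap; [_,_]′)
open import Data.Empty using (⊥-elim)
open import Function using (_∘_)
open import Relation.Nullary using (¬_; yes; no)
open import Relation.Binary.Definitions using (Symmetric; Irreflexive)
open import Relation.Binary.PropositionalEquality using (_≡_; refl; sym; trans; cong; cong₂; subst)

module _ {V : Set} where

  adjoined : ∀ {v x} {F : List V} → x ∈ v ∷ F → x ∉ F → x ≡ v
  adjoined (here refl) _   = refl
  adjoined (there x∈F) x∉F = ⊥-elim (x∉F x∈F)

  ∈△-adjoined : ∀ {v x} {F : List V} → x ∈△ F , (v ∷ F) → x ≡ v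
  ∈△-adjoined (inj₁ (x∈F , x∉v∷F)) = ⊥-elim (x∉v∷F (there x∈F))
  ∈△-adjoined (inj₂ (x∈v∷F , x∉F)) = adjoined x∈v∷F x∉F

  take-or-drop : ∀ h (N : List V) {x} → x ∈ N → x ∈ take h N ⊎ x ∈ drop h N
  take-or-drop h N {x} x∈N = ∈-++⁻ (take h N) (subst (x ∈_) (sym (take++drop≡id h N)) x∈N)

  ∈-drop⁻ : ∀ h (N : List V) {x} → x ∈ drop h N → x ∈ N
  ∈-drop⁻ h N {x} x∈drop = subst (x ∈_) (take++drop≡id h N) (∈-++⁺ʳ (take h N) x∈drop)

RefutedByNeighbourhoods : {V : Set} → ((V → V → Set) → ℕ → Set) → Set₁
RefutedByNeighbourhoods {V} Diag =
  ∀ {E : V → V → Set} → Symmetric E →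
  ∀ {v F} → v ∉ F → (∀ {w} → E v w → w ∈ F) →
  ∀ {t} → length F < t → ¬ Diag E t

module _ {V : Set} {E : V → V → Set} (E-sym : Symmetric E)
         {v : V} {F : List V} (v∉F : v ∉ F) (N[v]⊆F : ∀ {w} → E v w → w ∈ F)
         {t : ℕ} (|F|<t : length F < t) where

  private
    F≠v∷F : Distinct F (v ∷ F)
    F≠v∷F = v , inj₂ (here refl , v∉F)

  ¬PMC-Diagnosable : ¬ PMC-Diagnosable E t
  ¬PMC-Diagnosable D with D F (v ∷ F) (<⇒≤ |F|<t) |F|<t F≠v∷F
  ... | u , x , Eux , (u∉F , _) , x∈△ with ∈△-adjoined x∈△
  ...   | refl = u∉F (N[v]⊆F (E-sym Eux))

  ¬MM*-Diagnosable : ¬ MM*-Diagnosable E t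
  ¬MM*-Diagnosable D with D F (v ∷ F) (<⇒≤ |F|<t) |F|<t F≠v∷F
  ... | inj₁ (u , _ , x , (u∉F , _) , _ , x∈△ , Eux , _) with ∈△-adjoined x∈△
  ...   | refl = u∉F (N[v]⊆F (E-sym Eux))
  ¬MM*-Diagnosable D | inj₂ (inj₁ (_ , _ , _ , (u∈F , u∉v∷F) , _)) = u∉v∷F (there u∈F)
  ¬MM*-Diagnosable D | inj₂ (inj₂ (u , _ , w , (u∈v∷F , u∉F) , _ , (w∉F , _) , Euw , _))
    with adjoined u∈v∷F u∉F
  ...   | refl = w∉F (N[v]⊆F Euw)

spokes : {V : Set} → V → List V → List (V × V)
spokes v = map (v ,_)

record NeighbourList {V : Set} (E : V → V → Set) (v : V) (N : List V) : Set where
  field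
    adjacent : All (E v) N
    complete : ∀ {w} → E v w → w ∈ N

module _ {V : Set} {E : V → V → Set} (E-sym : Symmetric E) (E-irrefl : Irreflexive _≡_ E)
         {v : V} {N : List V} (isNeighbourList : NeighbourList E v N) where

  open NeighbourList isNeighbourList

  private
    v∉N : v ∉ N
    v∉N v∈N = E-irrefl refl (All.lookup adjacent v∈N)

    RemoveEdges-sym : ∀ {Fe} → Symmetric (RemoveEdges E Fe)
    RemoveEdges-sym (Euw , uw∉Fe) = E-sym Euw , uw∉Fe ∘ swap

  surviving-neighbours : ∀ h {w} → RemoveEdges E (spokes v (take h N)) v w → w ∈ drop h N
  surviving-neighbours h (Evw , vw∉spokes) with take-or-drop h N (complete Evw)
  ... | inj₁ w∈take = ⊥-elim (vw∉spokes (inj₁ (∈-map⁺ (v ,_) w∈take)))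
  ... | inj₂ w∈drop = w∈drop

  edgeTolerable-≤ : ∀ {Diag} → RefutedByNeighbourhoods Diag →
                    ∀ h t → EdgeTolerable Diag E h t → t ≤ length N ∸ h
  edgeTolerable-≤ refuted h t tolerable with t ≤? length N ∸ h
  ... | yes t≤ = t≤
  ... | no t≰ = ⊥-elim (refuted RemoveEdges-sym (v∉N ∘ ∈-drop⁻ h N) (surviving-neighbours h)
                                 |drop|<t (tolerable Fe |Fe|≤h Fe⊆E))
    where
    Fe = spokes v (take h N)

    |drop|<t : length (drop h N) < t
    |drop|<t = subst (_< t) (sym (length-drop h N)) (≰⇒> t≰)

    |Fe|≤h : length Fe ≤ h
    |Fe|≤h = ≤-trans (≤-reflexive (trans (length-map (v ,_) (take h N)) (length-take h N))) (m⊓n≤m h _)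

    Fe⊆E : All (uncurry E) Fe
    Fe⊆E = All.map⁺ (All.take⁺ h adjacent)

inc4-dec4 : ∀ x → inc4 (dec4 x) ≡ x
inc4-dec4 0F                = refl
inc4-dec4 (1+ 0F)           = refl
inc4-dec4 (1+ (1+ 0F))      = refl
inc4-dec4 (1+ (1+ (1+ 0F))) = refl

dec4-inc4 : ∀ x → dec4 (inc4 x) ≡ x
dec4-inc4 0F                = refl
dec4-inc4 (1+ 0F)           = refl
dec4-inc4 (1+ (1+ 0F))      = refl
dec4-inc4 (1+ (1+ (1+ 0F))) = refl

PlusMinusOne-sym : Symmetric PlusMinusOne
PlusMinusOne-sym (inj₁ refl) = inj₂ (sym (dec4-inc4 _))
PlusMinusOne-sym (inj₂ refl) = inj₁ (sym (inc4-dec4 _))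

PlusMinusOne-irrefl : Irreflexive _≡_ PlusMinusOne
PlusMinusOne-irrefl {0F}                refl (inj₁ ())
PlusMinusOne-irrefl {0F}                refl (inj₂ ())
PlusMinusOne-irrefl {1+ 0F}             refl (inj₁ ())
PlusMinusOne-irrefl {1+ 0F}             refl (inj₂ ())
PlusMinusOne-irrefl {1+ (1+ 0F)}        refl (inj₁ ())
PlusMinusOne-irrefl {1+ (1+ 0F)}        refl (inj₂ ())
PlusMinusOne-irrefl {1+ (1+ (1+ 0F))}   refl (inj₁ ())
PlusMinusOne-irrefl {1+ (1+ (1+ 0F))}   refl (inj₂ ())

-- a ± 1 has the parity opposite to a, so its flip is the inverse one.
flipBy-inverse : ∀ {a b} → PlusMinusOne a b → ∀ x → flipBy b (flipBy a x) ≡ x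
flipBy-inverse {0F}                (inj₁ refl) = dec4-inc4
flipBy-inverse {0F}                (inj₂ refl) = dec4-inc4
flipBy-inverse {1+ 0F}             (inj₁ refl) = inc4-dec4
flipBy-inverse {1+ 0F}             (inj₂ refl) = inc4-dec4
flipBy-inverse {1+ (1+ 0F)}        (inj₁ refl) = dec4-inc4
flipBy-inverse {1+ (1+ 0F)}        (inj₂ refl) = dec4-inc4
flipBy-inverse {1+ (1+ (1+ 0F))}   (inj₁ refl) = inc4-dec4
flipBy-inverse {1+ (1+ (1+ 0F))}   (inj₂ refl) = inc4-dec4

BHAdj-sym : ∀ {n} → Symmetric (BHAdj {n})
BHAdj-sym (inner ab) = inner (PlusMinusOne-sym ab)
BHAdj-sym (outer {a = a} {b} {rest} i ab) =
  subst (BHAdj (b ∷ rest [ i ]%= flipBy a) ∘ (a ∷_)) flip-back (outer i (PlusMinusOne-sym ab))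
  where
  flip-back : rest [ i ]%= flipBy a [ i ]%= flipBy b ≡ rest
  flip-back = trans ([]%=-∘ rest i) (trans (updateAt-cong i (flipBy-inverse ab) rest) ([]%=-id rest i))

BHAdj-irrefl : ∀ {n} → Irreflexive _≡_ (BHAdj {n})
BHAdj-irrefl eq (inner ab)   = PlusMinusOne-irrefl (∷-injectiveˡ eq) ab
BHAdj-irrefl eq (outer _ ab) = PlusMinusOne-irrefl (∷-injectiveˡ eq) ab

BH-sym : ∀ n → Symmetric (BH n)
BH-sym n = swap

BH-irrefl : ∀ n → Irreflexive _≡_ (BH n)
BH-irrefl n eq (inj₁ uv) = BHAdj-irrefl eq uv
BH-irrefl n eq (inj₂ vu) = BHAdj-irrefl (sym eq) vu

towards : ∀ {m} → Fin 4 → Vertex (suc m) → List (Vertex (suc m))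
towards b (a ∷ rest) = (b ∷ rest) ∷ tabulate (λ i → b ∷ rest [ i ]%= flipBy a)

neighbours : ∀ {m} → Vertex (suc m) → List (Vertex (suc m))
neighbours u@(a ∷ _) = towards (inc4 a) u ++ towards (dec4 a) u

length-neighbours : ∀ {m} (u : Vertex (suc m)) → length (neighbours u) ≡ 2 * suc m
length-neighbours {m} u@(a ∷ rest) = trans (length-++ (towards (inc4 a) u))
  (cong₂ _+_ (length-towards (inc4 a)) (trans (length-towards (dec4 a)) (sym (+-identityʳ (suc m)))))
  where
  length-towards : ∀ b → length (towards b u) ≡ suc m
  length-towards b = cong suc (length-tabulate (λ i → b ∷ rest [ i ]%= flipBy a))

towards-adjacent : ∀ {m a b} {rest : Vertex m} → PlusMinusOne a b →
                   All (BH (suc m) (a ∷ rest)) (towards b (a ∷ rest))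
towards-adjacent ab = inj₁ (inner ab) ∷ All.tabulate⁺ (λ i → inj₁ (outer i ab))

BHAdj⇒∈-towards : ∀ {m a} {rest : Vertex m} {w} → BHAdj (a ∷ rest) w →
                  w ∈ towards (inc4 a) (a ∷ rest) ⊎ w ∈ towards (dec4 a) (a ∷ rest)
BHAdj⇒∈-towards (inner (inj₁ refl))   = inj₁ (here refl)
BHAdj⇒∈-towards (inner (inj₂ refl))   = inj₂ (here refl)
BHAdj⇒∈-towards (outer i (inj₁ refl)) = inj₁ (there (∈-tabulate⁺ i))
BHAdj⇒∈-towards (outer i (inj₂ refl)) = inj₂ (there (∈-tabulate⁺ i))

BHAdj⇒∈-neighbours : ∀ {m} {u w : Vertex (suc m)} → BHAdj u w → w ∈ neighbours u
BHAdj⇒∈-neighbours {u = u@(a ∷ _)} = [ ∈-++⁺ˡ , ∈-++⁺ʳ (towards (inc4 a) u) ]′ ∘ BHAdj⇒∈-towards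

neighbours-NeighbourList : ∀ {m} (u : Vertex (suc m)) → NeighbourList (BH (suc m)) u (neighbours u)
neighbours-NeighbourList (a ∷ rest) = record
  { adjacent = All.++⁺ (towards-adjacent (inj₁ refl)) (towards-adjacent (inj₂ refl))
  ; complete = λ { (inj₁ uw) → BHAdj⇒∈-neighbours uw ; (inj₂ wu) → BHAdj⇒∈-neighbours (BHAdj-sym wu) }
  }

corollary3p2 : (n : ℕ) → 1 ≤ n → (h : ℕ) → h ≤ 2 * n →
    ((t : ℕ) → EdgeTolerable PMC-Diagnosable (BH n) h t → t ≤ 2 * n ∸ h)
    × ((t : ℕ) → EdgeTolerable MM*-Diagnosable (BH n) h t → t ≤ 2 * n ∸ h)
corollary3p2 (suc m) _ h _ = bound ¬PMC-Diagnosable , bound ¬MM*-Diagnosable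
  where
  origin : Vertex (suc m)
  origin = replicate (suc m) 0F

  bound : ∀ {Diag} → RefutedByNeighbourhoods Diag →
          ∀ t → EdgeTolerable Diag (BH (suc m)) h t → t ≤ 2 * suc m ∸ h
  bound refuted t tolerable =
    subst (λ d → t ≤ d ∸ h) (length-neighbours origin)
      (edgeTolerable-≤ (BH-sym _) (BH-irrefl _) (neighbours-NeighbourList origin) refuted h t tolerable)
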